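{- Define, for all $i\in[m]$, $t\in[T+1]$, $s\in\mathcal S$, \[ \hat\beta^t_i(s)=\frac{1}{C_i}\sum_{j\in\mathcal B_i}\nu^t_j(s),\qquad \hat\theta^t(s)=\sum_{j\in[n]}\nu^t_j(s). \] Then $\{\hat\theta^t(s),\hat\beta^t_i(s)\}_{t\in[T],i\in[m],s\in\mathcal S}$ is a feasible solution of the linear program described in the context, and \[ \sum_{s\in\mathcal S}p_1(s)\Big(\hat\theta^1(s)+\sum_{i\in[m]}C_i\hat\beta^1_i(s)\Big)\ \le\ (1+L)\sum_{s\in\mathcal S}p_1(s)\sum_{j\in[n]}\nu^1_j(s), \] where $L=\max_{j\in[n]}\sum_{i\in[m]}a_{i,j}$.
   Context: There are $m$ resources with capacities $C_i>0$; types $j\in[n]$ with reward $r_j$ and size $\bm a_j\in\{0,1\}^m$ (entries $a_{i,j}$); $\mathcal A_j=\{i:a_{i,j}=1\}$, $\mathcal B_i=\{j:a_{i,j}=1\}$. Finite state space $\mathcal S$, map $s\mapsto j(s)\in[n]$, initial distribution $p_1(s)$, transition probabilities $p_t(s,s')$ for $t\in[T]$. Bid prices: $\nu^{T+1}_j(s)=0$; for $t=T,\dots,1$, \[ \nu^t_j(s)=\sum_{s'}p_t(s,s')\nu^{t+1}_j(s')+\mathbb 1_{\{j=j(s)\}}\Big[r_j-\sum_{s'}p_t(s,s')\sum_{i\in\mathcal A_j}\frac{1}{C_i}\sum_{j'\in\mathcal B_i}\nu^{t+1}_{j'}(s')\Big]^+ . \] The LP has variables $\theta^t(s)\ge0$,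 $\beta^t_i(s)\ge0$ for $t\in[T]$ (with $\theta^{T+1}\equiv\beta^{T+1}\equiv0$): minimize $\sum_{s}p_1(s)\big(\theta^1(s)+\sum_iC_i\beta^1_i(s)\big)$ subject to, for all $t\in[T]$, $s\in\mathcal S$, \[ \theta^t(s)-\sum_{s'}p_t(s,s')\theta^{t+1}(s')\ \ge\ \Big[r_{j(s)}-\sum_{s'}p_t(s,s')\sum_{i}a_{i,j(s)}\beta^{t+1}_i(s')\Big]^+ +\sum_{i}C_i\Big[\sum_{s'}p_t(s,s')\beta^{t+1}_i(s')-\beta^t_i(s)\Big]^+ . \]
   Formalization: The capacities $C_i$, the rewards $r_j$ and the probabilities $p_1(s)$ and $p_t(s,s')$ are rational. -}

module Defs where

open import Data.Nat as ℕ using (ℕ; zero; suc; _∸_; _≤ᵇ_)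
open import Data.Fin using (Fin)
open import Data.Bool using (Bool; true; false; if_then_else_)
open import Data.Rational using (ℚ; 0ℚ; 1ℚ; _+_; _*_; _-_; _≤_; _<_; _⊔_; 1/_; positive)
open import Data.Rational.Properties using (pos⇒nonZero)
open import Relation.Binary.PropositionalEquality using (_≡_)
open import Data.Product using (_×_)
import Data.Fin
import Relation.Nullary

Σ : ∀ {k : ℕ} → (Fin k → ℚ) → ℚ
Σ {zero}  f = 0ℚ
Σ {suc k} f = f Data.Fin.zero + Σ {k} (λ x → f (Data.Fin.suc x))

-- Finite max over Fin k (with base value 0; all values used are ≥ 0).
Max : ∀ {k : ℕ} → (Fin k → ℚ) → ℚ
Max {zero}  f = 0ℚ
Max {suc k} f = f Data.Fin.zero ⊔ Max {k} (λ x → f (Data.Fin.suc x))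

pos : ℚ → ℚ
pos x = x ⊔ 0ℚ

ind : Bool → ℚ
ind true  = 1ℚ
ind false = 0ℚ

-- A network revenue management instance.
-- States are Fin K; time periods t ∈ [T] = {1,…,T}; transitions p t s s'.
record Instance : Set where
  field
    m n K T : ℕ
    C    : Fin m → ℚ
    Cpos : ∀ i → 0ℚ < C i
    r    : Fin n → ℚ
    a    : Fin m → Fin n → Bool          -- a i j = true  ⇔  a_{i,j} = 1
    jOf  : Fin K → Fin n
    p₁   : Fin K → ℚ
    p    : ℕ → Fin K → Fin K → ℚ         -- p t s s'  (used for t ∈ [T])
    p₁-nonneg : ∀ s → 0ℚ ≤ p₁ s
    p₁-sum    : Σ p₁ ≡ 1ℚ
    p-nonneg  : ∀ t → 1 ℕ.≤ t → t ℕ.≤ T → ∀ s s' → 0ℚ ≤ p t s s'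
    p-sum     : ∀ t → 1 ℕ.≤ t → t ℕ.≤ T → ∀ s → Σ (p t s) ≡ 1ℚ

module _ (I : Instance) where
  open Instance I

  invC : Fin m → ℚ
  invC i = (1/ (C i)) {{pos⇒nonZero (C i) {{positive (Cpos i)}}}}

  sameType : Fin n → Fin K → ℚ
  sameType j s with Data.Fin._≟_ j (jOf s)
  ... | Relation.Nullary.yes _ = 1ℚ
  ... | Relation.Nullary.no  _ = 0ℚ

  -- Bid prices by number of remaining steps: νRem k corresponds to time t = T+1-k.
  -- νRem 0 = ν^{T+1} = 0, and νRem (suc k) = ν^{T-k} uses p_{T-k}.
  νRem : ℕ → Fin n → Fin K → ℚ
  νRem zero    j s = 0ℚ
  νRem (suc k) j s =
    Σ (λ s' → p (T ∸ k) s s' * νRem k j s')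
    + sameType j s *
      pos (r j - Σ (λ s' → p (T ∸ k) s s' *
                  Σ (λ i → ind (a i j) * (invC i * Σ (λ j' → ind (a i j') * νRem k j' s')))))

  -- ν^t_j(s) for t ∈ [T+1]  (ν^t = 0 for t ≥ T+1)
  ν : ℕ → Fin n → Fin K → ℚ
  ν t = νRem (suc T ∸ t)

  -- Convention θ^{T+1} ≡ β^{T+1} ≡ 0: values of LP variables at times t > T are read as 0.
  ext : {A : Set} → (A → ℚ) → ℕ → A → ℚ
  ext f t x = if t ≤ᵇ T then f x else 0ℚ

  Feasible : (ℕ → Fin K → ℚ) → (ℕ → Fin m → Fin K → ℚ) → Set
  Feasible θ β =
    ∀ t → 1 ℕ.≤ t → t ℕ.≤ T → ∀ s →
      (0ℚ ≤ θ t s) × (∀ i → 0ℚ ≤ β t i s) ×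
      (pos (r (jOf s) - Σ (λ s' → p t s s' * Σ (λ i → ind (a i (jOf s)) * ext (λ x → β (suc t) i x) (suc t) s')))
       + Σ (λ i → C i * pos (Σ (λ s' → p t s s' * ext (λ x → β (suc t) i x) (suc t) s') - β t i s))
       ≤ θ t s - Σ (λ s' → p t s s' * ext (θ (suc t)) (suc t) s'))

  Objective : (ℕ → Fin K → ℚ) → (ℕ → Fin m → Fin K → ℚ) → ℚ
  Objective θ β = Σ (λ s → p₁ s * (θ 1 s + Σ (λ i → C i * β 1 i s)))

  β̂ : ℕ → Fin m → Fin K → ℚ
  β̂ t i s = invC i * Σ (λ j → ind (a i j) * ν t j s)

  θ̂ : ℕ → Fin K → ℚ
  θ̂ t s = Σ (λ j → ν t j s)

  L : ℚ
  L = Max (λ j → Σ (λ i → ind (a i j)))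

{-# OPTIONS --safe #-}
-- Both θ̂ and β̂ are nonnegative linear images of the bid prices ν. The positive
-- part in the bid-price recursion is nonnegative, so E[ν^{t+1}_j] ≤ ν^t_j, hence
-- E[β̂^{t+1}_i] ≤ β̂^t_i and every capacity term of the LP constraint vanishes.
-- Summing the recursion over j, only j = j(s) collects its positive part, so
-- θ̂^t − E[θ̂^{t+1}] is exactly the reward term: each constraint holds with
-- equality. For the objective, Σ_i C_i β̂^1_i = Σ_j (Σ_i a_{i,j}) ν^1_j ≤ L θ̂^1.
module Submission where

open import Defs
open import Algebra.Bundles using (Ring; CommutativeMonoid)
open import Data.Bool using (true; false)
open import Data.Fin using (Fin; zero; suc; punchIn; _≟_)
open import Data.Fin.Properties using (punchInᵢ≢i)
import Data.Nat as ℕ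
open ℕ using (ℕ; zero; suc; _∸_; _≤ᵇ_)
import Data.Nat.Properties as ℕₚ
open import Data.Product using (_×_; _,_)
open import Data.Rational using (ℚ; 0ℚ; 1ℚ; _+_; _*_; _-_; -_; _≤_; positive; nonNegative)
open import Data.Rational.Properties hiding (_≟_)
open import Relation.Nullary.Reflects using (ofʸ; ofⁿ)
open import Function using (_∘_)
open import Relation.Binary.PropositionalEquality
open import Relation.Nullary using (yes; no; contradiction)

open import Algebra.Properties.Semiring.Sum (Ring.semiring +-*-ring)
  using ( sum; sum-cong-≗; sum-replicate-zero; sum-remove
        ; ∑-distrib-+; ∑-comm; *-distribˡ-sum; *-distribʳ-sum)
open import Algebra.Properties.CommutativeSemigroup (CommutativeMonoid.commutativeSemigroup *-1-commutativeMonoid)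
  using (x∙yz≈y∙xz)
open import Algebra.Properties.AbelianGroup +-0-abelianGroup using (xyx⁻¹≈y)

Σ≗sum : ∀ {k} → Σ {k} ≗ sum {k}
Σ≗sum {zero}  f = refl
Σ≗sum {suc k} f = cong (f zero +_) (Σ≗sum (f ∘ suc))

Σ-cong : ∀ {k} {f g : Fin k → ℚ} → f ≗ g → Σ f ≡ Σ g
Σ-cong {f = f} {g} f≗g = begin
  Σ f   ≡⟨ Σ≗sum f ⟩
  sum f ≡⟨ sum-cong-≗ f≗g ⟩
  sum g ≡⟨ Σ≗sum g ⟨
  Σ g   ∎
  where open ≡-Reasoning

Σ-zero : ∀ {k} {f : Fin k → ℚ} → (∀ x → f x ≡ 0ℚ) → Σ f ≡ 0ℚ
Σ-zero {k} f≡0 =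
  trans (Σ-cong {g = λ _ → 0ℚ} f≡0) (trans (Σ≗sum {k} (λ _ → 0ℚ)) (sum-replicate-zero k))

Σ-+ : ∀ {k} (f g : Fin k → ℚ) → Σ (λ x → f x + g x) ≡ Σ f + Σ g
Σ-+ f g = begin
  Σ (λ x → f x + g x)   ≡⟨ Σ≗sum (λ x → f x + g x) ⟩
  sum (λ x → f x + g x) ≡⟨ ∑-distrib-+ f g ⟩
  sum f + sum g         ≡⟨ cong₂ _+_ (Σ≗sum f) (Σ≗sum g) ⟨
  Σ f + Σ g             ∎
  where open ≡-Reasoning

Σ-*ˡ : ∀ {k} c (f : Fin k → ℚ) → Σ (λ x → c * f x) ≡ c * Σ f
Σ-*ˡ c f = begin
  Σ (λ x → c * f x)   ≡⟨ Σ≗sum (λ x → c * f x) ⟩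
  sum (λ x → c * f x) ≡⟨ *-distribˡ-sum c f ⟨
  c * sum f           ≡⟨ cong (c *_) (Σ≗sum f) ⟨
  c * Σ f             ∎
  where open ≡-Reasoning

Σ-*ʳ : ∀ {k} c (f : Fin k → ℚ) → Σ (λ x → f x * c) ≡ Σ f * c
Σ-*ʳ c f = begin
  Σ (λ x → f x * c)   ≡⟨ Σ≗sum (λ x → f x * c) ⟩
  sum (λ x → f x * c) ≡⟨ *-distribʳ-sum c f ⟨
  sum f * c           ≡⟨ cong (_* c) (Σ≗sum f) ⟨
  Σ f * c             ∎
  where open ≡-Reasoning

Σ-swap : ∀ {k l} (f : Fin k → Fin l → ℚ) → Σ (λ x → Σ (f x)) ≡ Σ (λ y → Σ (λ x → f x y))
Σ-swap f = begin
  Σ (λ x → Σ (f x))               ≡⟨ Σ²≡sum² f ⟩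
  sum (λ x → sum (f x))           ≡⟨ ∑-comm f ⟩
  sum (λ y → sum (λ x → f x y))   ≡⟨ Σ²≡sum² (λ y x → f x y) ⟨
  Σ (λ y → Σ (λ x → f x y))       ∎
  where
  open ≡-Reasoning
  Σ²≡sum² : ∀ {k l} (g : Fin k → Fin l → ℚ) → Σ (λ x → Σ (g x)) ≡ sum (λ x → sum (g x))
  Σ²≡sum² g = trans (Σ≗sum (λ x → Σ (g x))) (sum-cong-≗ (λ x → Σ≗sum (g x)))

Σ-single : ∀ {k} (f : Fin k → ℚ) i → (∀ j → j ≢ i → f j ≡ 0ℚ) → Σ f ≡ f i
Σ-single {suc k} f i f≡0 = begin
  Σ f                         ≡⟨ Σ≗sum f ⟩
  sum f                       ≡⟨ sum-remove {i = i} f ⟩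
  f i + sum (f ∘ punchIn i)   ≡⟨ cong (f i +_) rest≡0 ⟩
  f i + 0ℚ                    ≡⟨ +-identityʳ (f i) ⟩
  f i                         ∎
  where
  open ≡-Reasoning
  rest≡0 : sum (f ∘ punchIn i) ≡ 0ℚ
  rest≡0 = trans (sym (Σ≗sum (f ∘ punchIn i)))
                 (Σ-zero (λ x → f≡0 (punchIn i x) (punchInᵢ≢i i x)))

Σ-mono : ∀ {k} {f g : Fin k → ℚ} → (∀ x → f x ≤ g x) → Σ f ≤ Σ g
Σ-mono {zero}  f≤g = ≤-refl
Σ-mono {suc k} f≤g = +-mono-≤ (f≤g zero) (Σ-mono (f≤g ∘ suc))

Σ-nonNeg : ∀ {k} {f : Fin k → ℚ} → (∀ x → 0ℚ ≤ f x) → 0ℚ ≤ Σ f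
Σ-nonNeg {k} f≥0 =
  ≤-trans (≤-reflexive (sym (Σ-zero {k} {λ _ → 0ℚ} (λ _ → refl)))) (Σ-mono f≥0)

Max-ub : ∀ {k} (f : Fin k → ℚ) x → f x ≤ Max f
Max-ub f zero    = p≤p⊔q (f zero) _
Max-ub f (suc x) = ≤-trans (Max-ub (f ∘ suc) x) (p≤q⊔p (f zero) _)

+-nonNeg : ∀ {p q} → 0ℚ ≤ p → 0ℚ ≤ q → 0ℚ ≤ p + q
+-nonNeg {p} {q} p≥0 q≥0 =
  nonNegative⁻¹ _ {{nonNeg+nonNeg⇒nonNeg p {{nonNegative p≥0}} q {{nonNegative q≥0}}}}

*-nonNeg : ∀ {p q} → 0ℚ ≤ p → 0ℚ ≤ q → 0ℚ ≤ p * q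
*-nonNeg {p} {q} p≥0 q≥0 =
  nonNegative⁻¹ _ {{nonNeg*nonNeg⇒nonNeg p {{nonNegative p≥0}} q {{nonNegative q≥0}}}}

ind-nonNeg : ∀ b → 0ℚ ≤ ind b
ind-nonNeg true  = nonNegative⁻¹ 1ℚ
ind-nonNeg false = ≤-refl

pos-nonNeg : ∀ x → 0ℚ ≤ pos x
pos-nonNeg x = p≤q⊔p x 0ℚ

p≤q⇒pos[p-q]≡0 : ∀ {p q} → p ≤ q → pos (p - q) ≡ 0ℚ
p≤q⇒pos[p-q]≡0 {p} {q} p≤q = p≤q⇒p⊔q≡q (begin
  p - q ≤⟨ +-monoˡ-≤ (- q) p≤q ⟩
  q - q ≡⟨ +-inverseʳ q ⟩
  0ℚ    ∎)
  where open ≤-Reasoning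

infix 7 _·_

_·_ : ∀ {k} → (Fin k → ℚ) → (Fin k → ℚ) → ℚ
P · f = Σ λ x → P x * f x

·-congʳ : ∀ {k} (P : Fin k → ℚ) {f g : Fin k → ℚ} → f ≗ g → P · f ≡ P · g
·-congʳ P f≗g = Σ-cong (λ x → cong (P x *_) (f≗g x))

·-zeroʳ : ∀ {k} (P : Fin k → ℚ) {f : Fin k → ℚ} → (∀ x → f x ≡ 0ℚ) → P · f ≡ 0ℚ
·-zeroʳ P f≡0 = Σ-zero (λ x → trans (cong (P x *_) (f≡0 x)) (*-zeroʳ (P x)))

·-*ʳ : ∀ {k} (P : Fin k → ℚ) c (f : Fin k → ℚ) → P · (λ x → c * f x) ≡ c * (P · f)
·-*ʳ P c f = trans (Σ-cong (λ x → x∙yz≈y∙xz (P x) c (f x))) (Σ-*ˡ c (λ x → P x * f x))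

·-Σʳ : ∀ {k l} (P : Fin k → ℚ) (g : Fin l → Fin k → ℚ) →
       P · (λ x → Σ λ y → g y x) ≡ Σ λ y → P · g y
·-Σʳ P g = trans (Σ-cong (λ x → sym (Σ-*ˡ (P x) (λ y → g y x)))) (Σ-swap (λ x y → P x * g y x))

·-monoʳ-≤ : ∀ {k} {P f g : Fin k → ℚ} → (∀ x → 0ℚ ≤ P x) → (∀ x → f x ≤ g x) → P · f ≤ P · g
·-monoʳ-≤ {P = P} P≥0 f≤g = Σ-mono (λ x → *-monoˡ-≤-nonNeg (P x) {{nonNegative (P≥0 x)}} (f≤g x))

·-nonNeg : ∀ {k} {P f : Fin k → ℚ} → (∀ x → 0ℚ ≤ P x) → (∀ x → 0ℚ ≤ f x) → 0ℚ ≤ P · f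
·-nonNeg P≥0 f≥0 = Σ-nonNeg (λ x → *-nonNeg (P≥0 x) (f≥0 x))

module _ (I : Instance) where
  open Instance I

  βOf : (Fin n → Fin K → ℚ) → Fin m → Fin K → ℚ
  βOf V i s = invC I i * ((ind ∘ a i) · λ j → V j s)

  θOf : (Fin n → Fin K → ℚ) → Fin K → ℚ
  θOf V s = Σ λ j → V j s

  surplus : ℕ → (Fin n → Fin K → ℚ) → Fin n → Fin K → ℚ
  surplus u V j s = pos (r j - p u s · λ s′ → (λ i → ind (a i j)) · λ i → βOf V i s′)

  -- Definitionally νRem I (suc k) = νStep (T ∸ k) (νRem I k), β̂ I t = βOf (ν I t)
  -- and θ̂ I t = θOf (ν I t).
  νStep : ℕ → (Fin n → Fin K → ℚ) → Fin n → Fin K → ℚ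
  νStep u V j s = p u s · V j + sameType I j s * surplus u V j s

  -- The constraint of Feasible at (t, s) reads, definitionally,
  -- constraintLHS t s (λ i → ext I (β (suc t) i) (suc t)) (λ i → β t i s)
  --   ≤ θ t s - p t s · ext I (θ (suc t)) (suc t).
  constraintLHS : ℕ → Fin K → (Fin m → Fin K → ℚ) → (Fin m → ℚ) → ℚ
  constraintLHS u s β′ β =
    pos (r (jOf s) - p u s · λ s′ → (λ i → ind (a i (jOf s))) · λ i → β′ i s′)
    + Σ λ i → C i * pos (p u s · β′ i - β i)

  constraintLHS-cong : ∀ u s {β₁ β₂ : Fin m → Fin K → ℚ} {b₁ b₂ : Fin m → ℚ} →
                       (∀ i → β₁ i ≗ β₂ i) → b₁ ≗ b₂ →
                       constraintLHS u s β₁ b₁ ≡ constraintLHS u s β₂ b₂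
  constraintLHS-cong u s β₁≗β₂ b₁≗b₂ = cong₂ _+_
    (cong (λ z → pos (r (jOf s) - z))
          (·-congʳ (p u s) (λ s′ → ·-congʳ (λ i → ind (a i (jOf s))) (λ i → β₁≗β₂ i s′))))
    (Σ-cong (λ i → cong (λ z → C i * pos z)
                        (cong₂ _-_ (·-congʳ (p u s) (β₁≗β₂ i)) (b₁≗b₂ i))))

  sameType-nonNeg : ∀ j s → 0ℚ ≤ sameType I j s
  sameType-nonNeg j s with j ≟ jOf s
  ... | yes _ = nonNegative⁻¹ 1ℚ
  ... | no  _ = ≤-refl

  sameType-self : ∀ s → sameType I (jOf s) s ≡ 1ℚ
  sameType-self s with jOf s ≟ jOf s
  ... | yes _   = refl
  ... | no  j≢j = contradiction refl j≢j

  sameType-other : ∀ {j s} → j ≢ jOf s → sameType I j s ≡ 0ℚ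
  sameType-other {j} {s} j≢jOf with j ≟ jOf s
  ... | yes j≡jOf = contradiction j≡jOf j≢jOf
  ... | no  _     = refl

  Σ-sameType : ∀ s (f : Fin n → ℚ) → Σ (λ j → sameType I j s * f j) ≡ f (jOf s)
  Σ-sameType s f = begin
    Σ (λ j → sameType I j s * f j)   ≡⟨ Σ-single _ (jOf s) off-diagonal ⟩
    sameType I (jOf s) s * f (jOf s) ≡⟨ cong (_* f (jOf s)) (sameType-self s) ⟩
    1ℚ * f (jOf s)                   ≡⟨ *-identityˡ (f (jOf s)) ⟩
    f (jOf s)                        ∎
    where
    open ≡-Reasoning
    off-diagonal : ∀ j → j ≢ jOf s → sameType I j s * f j ≡ 0ℚ
    off-diagonal j j≢jOf = trans (cong (_* f j) (sameType-other j≢jOf)) (*-zeroˡ (f j))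

  invC-nonNeg : ∀ i → 0ℚ ≤ invC I i
  invC-nonNeg i = nonNegative⁻¹ (invC I i)
    {{pos⇒nonNeg (invC I i) {{1/pos⇒pos (C i) {{positive (Cpos i)}}}}}}

  C*[invC*x]≡x : ∀ i x → C i * (invC I i * x) ≡ x
  C*[invC*x]≡x i x = begin
    C i * (invC I i * x) ≡⟨ *-assoc (C i) (invC I i) x ⟨
    C i * invC I i * x   ≡⟨ cong (_* x) C*invC≡1 ⟩
    1ℚ * x               ≡⟨ *-identityˡ x ⟩
    x                    ∎
    where
    open ≡-Reasoning
    C*invC≡1 : C i * invC I i ≡ 1ℚ
    C*invC≡1 = *-inverseʳ (C i) {{pos⇒nonZero (C i) {{positive (Cpos i)}}}}

  surplus-nonNeg : ∀ u V j s → 0ℚ ≤ surplus u V j s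
  surplus-nonNeg u V j s =
    pos-nonNeg (r j - p u s · λ s′ → (λ i → ind (a i j)) · λ i → βOf V i s′)

  ·≤νStep : ∀ u V j s → p u s · V j ≤ νStep u V j s
  ·≤νStep u V j s = ≤-trans (≤-reflexive (sym (+-identityʳ (p u s · V j))))
    (+-monoʳ-≤ (p u s · V j) (*-nonNeg (sameType-nonNeg j s) (surplus-nonNeg u V j s)))

  νStep-nonNeg : ∀ u V j s → (∀ s′ → 0ℚ ≤ p u s s′) → (∀ j s′ → 0ℚ ≤ V j s′) → 0ℚ ≤ νStep u V j s
  νStep-nonNeg u V j s p≥0 V≥0 =
    +-nonNeg (·-nonNeg p≥0 (V≥0 j)) (*-nonNeg (sameType-nonNeg j s) (surplus-nonNeg u V j s))

  βOf-cong : ∀ V W i s → (∀ j → V j s ≡ W j s) → βOf V i s ≡ βOf W i s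
  βOf-cong V W i s V≡W = cong (invC I i *_) (·-congʳ (ind ∘ a i) V≡W)

  βOf-mono : ∀ V W i s → (∀ j → V j s ≤ W j s) → βOf V i s ≤ βOf W i s
  βOf-mono V W i s V≤W = *-monoˡ-≤-nonNeg (invC I i) {{nonNegative (invC-nonNeg i)}}
    (·-monoʳ-≤ (ind-nonNeg ∘ a i) V≤W)

  βOf-nonNeg : ∀ V i s → (∀ j → 0ℚ ≤ V j s) → 0ℚ ≤ βOf V i s
  βOf-nonNeg V i s V≥0 = *-nonNeg (invC-nonNeg i) (·-nonNeg (ind-nonNeg ∘ a i) V≥0)

  ·-βOf : ∀ u V i s → p u s · βOf V i ≡ βOf (λ j _ → p u s · V j) i s
  ·-βOf u V i s = begin
    p u s · βOf V i
      ≡⟨ ·-*ʳ (p u s) (invC I i) _ ⟩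
    invC I i * (p u s · λ s′ → (ind ∘ a i) · λ j → V j s′)
      ≡⟨ cong (invC I i *_) (·-Σʳ (p u s) (λ j s′ → ind (a i j) * V j s′)) ⟩
    invC I i * Σ (λ j → p u s · λ s′ → ind (a i j) * V j s′)
      ≡⟨ cong (invC I i *_) (Σ-cong (λ j → ·-*ʳ (p u s) (ind (a i j)) (V j))) ⟩
    βOf (λ j _ → p u s · V j) i s
      ∎
    where open ≡-Reasoning

  ·βOf≤βOf-νStep : ∀ u V i s → p u s · βOf V i ≤ βOf (νStep u V) i s
  ·βOf≤βOf-νStep u V i s = ≤-trans (≤-reflexive (·-βOf u V i s))
    (βOf-mono (λ j _ → p u s · V j) (νStep u V) i s (λ j → ·≤νStep u V j s))

  θOf-νStep : ∀ u V s → θOf (νStep u V) s ≡ p u s · θOf V + surplus u V (jOf s) s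
  θOf-νStep u V s = begin
    θOf (νStep u V) s
      ≡⟨ Σ-+ (λ j → p u s · V j) (λ j → sameType I j s * surplus u V j s) ⟩
    Σ (λ j → p u s · V j) + Σ (λ j → sameType I j s * surplus u V j s)
      ≡⟨ cong₂ _+_ (sym (·-Σʳ (p u s) V)) (Σ-sameType s (λ j → surplus u V j s)) ⟩
    p u s · θOf V + surplus u V (jOf s) s
      ∎
    where open ≡-Reasoning

  constraintLHS-νStep : ∀ u V s →
    constraintLHS u s (βOf V) (λ i → βOf (νStep u V) i s) ≡ θOf (νStep u V) s - p u s · θOf V
  constraintLHS-νStep u V s = begin
    constraintLHS u s (βOf V) (λ i → βOf (νStep u V) i s)
      ≡⟨ cong (surplus u V (jOf s) s +_) (Σ-zero capacity-term≡0) ⟩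
    surplus u V (jOf s) s + 0ℚ
      ≡⟨ +-identityʳ _ ⟩
    surplus u V (jOf s) s
      ≡⟨ xyx⁻¹≈y (p u s · θOf V) (surplus u V (jOf s) s) ⟨
    p u s · θOf V + surplus u V (jOf s) s - p u s · θOf V
      ≡⟨ cong (_- p u s · θOf V) (θOf-νStep u V s) ⟨
    θOf (νStep u V) s - p u s · θOf V
      ∎
    where
    open ≡-Reasoning
    capacity-term≡0 : ∀ i → C i * pos (p u s · βOf V i - βOf (νStep u V) i s) ≡ 0ℚ
    capacity-term≡0 i =
      trans (cong (C i *_) (p≤q⇒pos[p-q]≡0 (·βOf≤βOf-νStep u V i s))) (*-zeroʳ (C i))

  ν-step : ∀ {t} → t ℕ.≤ T → ∀ j s → ν I t j s ≡ νStep t (ν I (suc t)) j s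
  ν-step {t} t≤T j s = begin
    νRem I (suc T ∸ t) j s   ≡⟨ cong (λ k → νRem I k j s) (ℕₚ.+-∸-assoc 1 t≤T) ⟩
    νRem I (suc (T ∸ t)) j s ≡⟨ cong (λ u → νStep u (ν I (suc t)) j s) (ℕₚ.m∸[m∸n]≡n t≤T) ⟩
    νStep t (ν I (suc t)) j s ∎
    where open ≡-Reasoning

  ν-beyond-horizon : ∀ {t} → T ℕ.< t → ∀ j s → ν I t j s ≡ 0ℚ
  ν-beyond-horizon T<t j s = cong (λ k → νRem I k j s) (ℕₚ.m≤n⇒m∸n≡0 T<t)

  νRem-nonNeg : ∀ k → k ℕ.≤ T → ∀ j s → 0ℚ ≤ νRem I k j s
  νRem-nonNeg zero    _   j s = ≤-refl
  νRem-nonNeg (suc k) k<T j s = νStep-nonNeg (T ∸ k) (νRem I k) j s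
    (p-nonneg (T ∸ k) (ℕₚ.m<n⇒0<n∸m k<T) (ℕₚ.m∸n≤m T k) s)
    (νRem-nonNeg k (ℕₚ.<⇒≤ k<T))

  -- ν I 0 involves p 0, on which the instance imposes nothing.
  ν-nonNeg : ∀ {t} → 1 ℕ.≤ t → ∀ j s → 0ℚ ≤ ν I t j s
  ν-nonNeg {t} 1≤t = νRem-nonNeg (suc T ∸ t) (ℕₚ.∸-monoʳ-≤ (suc T) 1≤t)

  ext-≡ : ∀ {A : Set} (f : A → ℚ) t x → (T ℕ.< t → f x ≡ 0ℚ) → ext I f t x ≡ f x
  ext-≡ f t x vanishes with t ≤ᵇ T | ℕₚ.≤ᵇ-reflects-≤ t T
  ... | true  | ofʸ _   = refl
  ... | false | ofⁿ t≰T = sym (vanishes (ℕₚ.≰⇒> t≰T))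

  β̂-ext : ∀ t i → ext I (β̂ I t i) t ≗ β̂ I t i
  β̂-ext t i x = ext-≡ (β̂ I t i) t x (λ T<t →
    trans (cong (invC I i *_) (·-zeroʳ (ind ∘ a i) (λ j → ν-beyond-horizon T<t j x)))
          (*-zeroʳ (invC I i)))

  θ̂-ext : ∀ t → ext I (θ̂ I t) t ≗ θ̂ I t
  θ̂-ext t x = ext-≡ (θ̂ I t) t x (λ T<t → Σ-zero (λ j → ν-beyond-horizon T<t j x))

  feasible : Feasible I (θ̂ I) (β̂ I)
  feasible t 1≤t t≤T s =
    Σ-nonNeg (λ j → ν-nonNeg 1≤t j s) ,
    (λ i → βOf-nonNeg (ν I t) i s (λ j → ν-nonNeg 1≤t j s)) ,
    ≤-reflexive (begin
      constraintLHS t s (λ i → ext I (β̂ I (suc t) i) (suc t)) (λ i → β̂ I t i s)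
        ≡⟨ constraintLHS-cong t s (β̂-ext (suc t))
             (λ i → βOf-cong (ν I t) (νStep t V) i s recursion) ⟩
      constraintLHS t s (βOf V) (λ i → βOf (νStep t V) i s)
        ≡⟨ constraintLHS-νStep t V s ⟩
      θOf (νStep t V) s - p t s · θOf V
        ≡⟨ cong₂ _-_ (Σ-cong recursion) (·-congʳ (p t s) (θ̂-ext (suc t))) ⟨
      θ̂ I t s - p t s · ext I (θ̂ I (suc t)) (suc t)
        ∎)
    where
    open ≡-Reasoning
    V : Fin n → Fin K → ℚ
    V = ν I (suc t)
    recursion : ∀ j → ν I t j s ≡ νStep t V j s
    recursion j = ν-step t≤T j s

  Σ-C*βOf : ∀ V s → Σ (λ i → C i * βOf V i s) ≡ Σ λ j → Σ (λ i → ind (a i j)) * V j s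
  Σ-C*βOf V s = begin
    Σ (λ i → C i * βOf V i s)                   ≡⟨ Σ-cong (λ i → C*[invC*x]≡x i _) ⟩
    Σ (λ i → Σ λ j → ind (a i j) * V j s)       ≡⟨ Σ-swap (λ i j → ind (a i j) * V j s) ⟩
    Σ (λ j → Σ λ i → ind (a i j) * V j s)       ≡⟨ Σ-cong (λ j → Σ-*ʳ (V j s) (λ i → ind (a i j))) ⟩
    Σ (λ j → Σ (λ i → ind (a i j)) * V j s)     ∎
    where open ≡-Reasoning

  Σ-C*βOf≤L*θOf : ∀ V s → (∀ j → 0ℚ ≤ V j s) → Σ (λ i → C i * βOf V i s) ≤ L I * θOf V s
  Σ-C*βOf≤L*θOf V s V≥0 = begin
    Σ (λ i → C i * βOf V i s)               ≡⟨ Σ-C*βOf V s ⟩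
    Σ (λ j → Σ (λ i → ind (a i j)) * V j s) ≤⟨ Σ-mono load≤L*V ⟩
    Σ (λ j → L I * V j s)                   ≡⟨ Σ-*ˡ (L I) (λ j → V j s) ⟩
    L I * θOf V s                           ∎
    where
    open ≤-Reasoning
    load≤L*V : ∀ j → Σ (λ i → ind (a i j)) * V j s ≤ L I * V j s
    load≤L*V j = *-monoʳ-≤-nonNeg (V j s) {{nonNegative (V≥0 j)}}
      (Max-ub (λ j′ → Σ λ i → ind (a i j′)) j)

  θOf+Σ-C*βOf≤[1+L]*θOf : ∀ V s → (∀ j → 0ℚ ≤ V j s) →
                          θOf V s + Σ (λ i → C i * βOf V i s) ≤ (1ℚ + L I) * θOf V s
  θOf+Σ-C*βOf≤[1+L]*θOf V s V≥0 = begin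
    θOf V s + Σ (λ i → C i * βOf V i s) ≤⟨ +-monoʳ-≤ (θOf V s) (Σ-C*βOf≤L*θOf V s V≥0) ⟩
    θOf V s + L I * θOf V s             ≡⟨ cong (_+ L I * θOf V s) (*-identityˡ (θOf V s)) ⟨
    1ℚ * θOf V s + L I * θOf V s        ≡⟨ *-distribʳ-+ (θOf V s) 1ℚ (L I) ⟨
    (1ℚ + L I) * θOf V s                ∎
    where open ≤-Reasoning

  objective-bound : Objective I (θ̂ I) (β̂ I) ≤ (1ℚ + L I) * (p₁ · θ̂ I 1)
  objective-bound = begin
    p₁ · (λ s → θ̂ I 1 s + Σ λ i → C i * β̂ I 1 i s)
      ≤⟨ ·-monoʳ-≤ p₁-nonneg
           (λ s → θOf+Σ-C*βOf≤[1+L]*θOf (ν I 1) s (λ j → ν-nonNeg ℕₚ.≤-refl j s)) ⟩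
    p₁ · (λ s → (1ℚ + L I) * θ̂ I 1 s)
      ≡⟨ ·-*ʳ p₁ (1ℚ + L I) (θ̂ I 1) ⟩
    (1ℚ + L I) * (p₁ · θ̂ I 1)
      ∎
    where open ≤-Reasoning

lemma3 : (I : Instance) →
    Feasible I (θ̂ I) (β̂ I) ×
    (Objective I (θ̂ I) (β̂ I)
      ≤ (1ℚ + L I) * Σ (λ s → Instance.p₁ I s * Σ (λ j → ν I 1 j s)))
lemma3 I = feasible I , objective-bound I
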